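{- Let $T$ be a balanced tree. Then $T$ is well-totally dominated if and only if (1) $\mathrm{height}(T)\le 3$, (2) for all $v\in V_2$, $|N(v)\cap V_1|=1$, and (3) for all $v\in V_1$, $|N(v)\cap V_2|\le 1$.
   Context: All graphs are finite and simple. $N(v)$ is the open neighborhood of $v$ and $N(S)=\bigcup_{v\in S}N(v)$. A leaf is a vertex of degree 1. The height of a vertex $v$ is the minimum distance from $v$ to a leaf (an isolated vertex has height 0); $V_k$ is the set of vertices of height $k$; $\mathrm{height}(T)$ is the largest $k$ with $V_k\ne\emptyset$. A tree is balanced if no two vertices of the same height are adjacent. A total dominating set (TDS) is a set $S$ with $N(S)=V(T)$; it is minimal if no proper subset is a TDS. A graph is well-totally dominated (WTD) if all its minimal TDSs have the same size (vacuously true if there are none). -}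

module Defs where

open import Data.Nat using (ℕ; zero; suc; _≤_; _<_)
open import Data.Bool using (Bool; T)
open import Data.Fin using (Fin; zero; suc; inject₁; fromℕ)
open import Data.Fin.Subset using (Subset; _∈_; _⊂_; ∣_∣)
open import Data.Vec using (tabulate)
open import Data.Product using (Σ; ∃; _×_)
open import Data.Sum using (_⊎_)
open import Relation.Nullary using (¬_)
open import Relation.Binary.PropositionalEquality using (_≡_)
open import Function.Definitions using (Injective)

record Graph (n : ℕ) : Set where
  field
    adj   : Fin n → Fin n → Bool
    sym   : ∀ u v → adj u v ≡ adj v u
    irrefl : ∀ v → adj v v ≡ Data.Bool.false

open Graph public

module _ {n : ℕ} (G : Graph n) where

  Adj : Fin n → Fin n → Set
  Adj u v = T (adj G u v)

  N : Fin n → Subset n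
  N v = tabulate (adj G v)

  deg : Fin n → ℕ
  deg v = ∣ N v ∣

  Leaf : Fin n → Set
  Leaf v = deg v ≡ 1

  Isolated : Fin n → Set
  Isolated v = deg v ≡ 0

  data Walk : Fin n → Fin n → ℕ → Set where
    here : ∀ {u} → Walk u u 0
    step : ∀ {u x w k} → Adj u x → Walk x w k → Walk u w (suc k)

  Connected : Set
  Connected = ∀ u v → ∃ λ k → Walk u v k

  record Cycle : Set where
    field
      m      : ℕ
      c      : Fin (suc (suc (suc m))) → Fin n
      inj    : Injective _≡_ _≡_ c
      consec : ∀ (i : Fin (suc (suc m))) → Adj (c (inject₁ i)) (c (suc i))
      close  : Adj (c (fromℕ (suc (suc m)))) (c zero)

  Acyclic : Set
  Acyclic = ¬ Cycle

  IsTree : Set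
  IsTree = (1 ≤ n) × Connected × Acyclic

  Height : Fin n → ℕ → Set
  Height v k =
      (Isolated v × k ≡ 0)
    ⊎ (¬ Isolated v × (Σ (Fin n) λ w → Leaf w × Walk v w k)
                    × (∀ w j → Leaf w → Walk v w j → k ≤ j))

  Balanced : Set
  Balanced = ∀ u v k → Adj u v → Height u k → ¬ Height v k

  IsTDS : Subset n → Set
  IsTDS S = ∀ v → Σ (Fin n) λ u → u ∈ S × Adj u v

  IsMinimalTDS : Subset n → Set
  IsMinimalTDS S = IsTDS S × (∀ S′ → S′ ⊂ S → ¬ IsTDS S′)

  WTD : Set
  WTD = ∀ S S′ → IsMinimalTDS S → IsMinimalTDS S′ → ∣ S ∣ ≡ ∣ S′ ∣

  Cond1 : Set
  Cond1 = ∀ v k → Height v k → k ≤ 3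

  Cond2 : Set
  Cond2 = ∀ v → Height v 2 →
    Σ (Fin n) λ u → Adj v u × Height u 1 ×
      (∀ w → Adj v w → Height w 1 → w ≡ u)

  Cond3 : Set
  Cond3 = ∀ v → Height v 1 →
    ∀ w w′ → Adj v w → Height w 2 → Adj v w′ → Height w′ 2 → w ≡ w′

-- In a balanced tree the heights of adjacent vertices differ by exactly one, so V₀ is the set
-- of leaves and V₁ the set of support vertices.  If (1)–(3) hold, a minimal TDS S contains V₁, misses V₃,
-- and adjacency matches S ∩ V₁ perfectly with S ∖ V₁; hence |S| = 2|V₁| for every minimal TDS.
-- Conversely, each violation of (1)–(3) produces two minimal TDSs of different sizes.  Root the tree at a
-- suitable vertex and exclude a set of vertices chosen so that the rest is still a TDS, but every minimal TDS
-- M inside it is forced to contain two vertices b₁, b₂ whose private duties a single vertex a can take over;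
-- then (M − b₁ − b₂) ∪ {a} is a TDS smaller than M.  A vertex of height 4 and a V₁-vertex with two
-- V₂-neighbours both reduce to one configuration: a path r s a q ℓ descending from the root r through
-- heights 3, 2, 1, 0, where every other child of r has a grandchild with no neighbour in V₁.

module Submission where

open import Defs hiding (sym)
open import Data.Nat using (ℕ; zero; suc; _+_; _∸_; _≤_; _<_; z≤n; s≤s; _≤?_)
open import Data.Nat.Properties hiding (_≟_)
open import Data.Nat.Properties using () renaming (_≟_ to _≟ℕ_)
open import Data.Bool using (Bool; T; if_then_else_)
open import Data.Bool.Properties using (T-≡)
open import Data.Fin using (Fin; zero; suc; toℕ)
open import Data.Fin.Properties using (_≟_; any?; all?; toℕ-injective; toℕ-inject₁; toℕ-fromℕ; toℕ<n)
open import Data.Fin.Subset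
  using (Subset; _∈_; _∉_; _⊆_; _⊂_; ∣_∣; _∪_; _∩_; ∁; _-_; ⁅_⁆; inside; outside)
open import Data.Fin.Subset.Properties
  using (_∈?_; x∈⁅x⁆; x∈⁅y⁆⇒x≡y; ∣⁅x⁆∣≡1; x∈p∪q⁺; p⊆q⇒∣p∣≤∣q∣; x∈p⇒∣p-x∣<∣p∣; x∈p⇒p-x⊂p;
         x∈p∧x≢y⇒x∈p-y; p─q⊆p; ⊆-refl; ⊆-trans; p⊂q⇒∣p∣<∣q∣; Empty-unique; ∣⊥∣≡0;
         x∈p∩q⁺; x∈p∩q⁻; x∉p⇒x∈∁p; x∈∁p⇒x∉p; p∩q⊆q; ⊆-antisym)
open import Data.Fin.Subset.Induction using (⊂-wellFounded)
open import Data.List using (allFin)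
open import Data.List.Extrema.Nat using (argmax; f[xs]≤f[argmax])
open import Data.List.Membership.Propositional.Properties using (∈-allFin)
import Data.List.Relation.Unary.All as All
open import Data.Vec using ([]; _∷_; tabulate)
open import Data.Vec.Properties using (lookup∘tabulate; lookup⇒[]=; []=⇒lookup)
open import Data.Product using (Σ-syntax; ∃; ∃-syntax; ∃₂; ∃!; _×_; _,_; proj₁; proj₂)
open import Data.Sum using (_⊎_; inj₁; inj₂; [_,_]′)
open import Data.Empty using (⊥; ⊥-elim)
open import Function using (_∘_; id; _⇔_; mk⇔; Equivalence)
open import Induction.WellFounded using (Acc; acc)
open import Relation.Nullary
  using (¬_; Dec; yes; no; does; contradiction; ¬?; _×-dec_; _⊎-dec_; map′; decidable-stable; T?)
open import Relation.Nullary.Decidable using (isYes; toWitness; fromWitness)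
open import Relation.Unary using (Decidable)
open import Relation.Binary.Definitions using (tri<; tri≈; tri>)
open import Relation.Binary.PropositionalEquality
  using (_≡_; _≢_; refl; sym; trans; cong; subst; subst₂; module ≡-Reasoning)
open import Algebra.Properties.CommutativeMonoid.Sum +-0-commutativeMonoid
  using (sum-syntax; ∑-comm; sum-cong-≗; sum-replicate-zero)

least : {P : ℕ → Set} → Decidable P → ∀ {k} → P k → Σ[ m ∈ ℕ ] P m × (∀ {j} → P j → m ≤ j)
least P? {zero} p = 0 , p , λ _ → z≤n
least P? {suc k} p with P? 0
... | yes p₀ = 0 , p₀ , λ _ → z≤n
... | no ¬p₀ with least (P? ∘ suc) p
...   | m , pm , min = suc m , pm , λ { {zero} p₀ → contradiction p₀ ¬p₀ ; {suc j} pj → s≤s (min pj) }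

∣p∪q∣≤∣p∣+∣q∣ : ∀ {n} (p q : Subset n) → ∣ p ∪ q ∣ ≤ ∣ p ∣ + ∣ q ∣
∣p∪q∣≤∣p∣+∣q∣ [] [] = z≤n
∣p∪q∣≤∣p∣+∣q∣ (outside ∷ p) (outside ∷ q) = ∣p∪q∣≤∣p∣+∣q∣ p q
∣p∪q∣≤∣p∣+∣q∣ (outside ∷ p) (inside ∷ q) =
  ≤-trans (s≤s (∣p∪q∣≤∣p∣+∣q∣ p q)) (≤-reflexive (sym (+-suc ∣ p ∣ ∣ q ∣)))
∣p∪q∣≤∣p∣+∣q∣ (inside ∷ p) (outside ∷ q) = s≤s (∣p∪q∣≤∣p∣+∣q∣ p q)
∣p∪q∣≤∣p∣+∣q∣ (inside ∷ p) (inside ∷ q) =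
  s≤s (≤-trans (∣p∪q∣≤∣p∣+∣q∣ p q) (+-monoʳ-≤ ∣ p ∣ (n≤1+n ∣ q ∣)))

∣p∣≡∣p∩q∣+∣p∩∁q∣ : ∀ {n} (p q : Subset n) → ∣ p ∣ ≡ ∣ p ∩ q ∣ + ∣ p ∩ ∁ q ∣
∣p∣≡∣p∩q∣+∣p∩∁q∣ [] [] = refl
∣p∣≡∣p∩q∣+∣p∩∁q∣ (outside ∷ p) (_ ∷ q) = ∣p∣≡∣p∩q∣+∣p∩∁q∣ p q
∣p∣≡∣p∩q∣+∣p∩∁q∣ (inside ∷ p) (outside ∷ q) =
  trans (cong suc (∣p∣≡∣p∩q∣+∣p∩∁q∣ p q)) (sym (+-suc ∣ p ∩ q ∣ ∣ p ∩ ∁ q ∣))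
∣p∣≡∣p∩q∣+∣p∩∁q∣ (inside ∷ p) (inside ∷ q) = cong suc (∣p∣≡∣p∩q∣+∣p∩∁q∣ p q)

⁅x⁆⊆p : ∀ {n} {x : Fin n} {p : Subset n} → x ∈ p → ⁅ x ⁆ ⊆ p
⁅x⁆⊆p {x = x} x∈p y∈⁅x⁆ = subst (_∈ _) (sym (x∈⁅y⁆⇒x≡y x y∈⁅x⁆)) x∈p

x∈p⇒1≤∣p∣ : ∀ {n} {x : Fin n} {p : Subset n} → x ∈ p → 1 ≤ ∣ p ∣
x∈p⇒1≤∣p∣ {x = x} x∈p = subst (_≤ _) (∣⁅x⁆∣≡1 x) (p⊆q⇒∣p∣≤∣q∣ (⁅x⁆⊆p x∈p))

∈-tabulate⁺ : ∀ {n} {f : Fin n → Bool} {x : Fin n} → T (f x) → x ∈ tabulate f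
∈-tabulate⁺ {f = f} {x} t = lookup⇒[]= x (tabulate f) (trans (lookup∘tabulate f x) (Equivalence.to T-≡ t))

∈-tabulate⁻ : ∀ {n} {f : Fin n → Bool} {x : Fin n} → x ∈ tabulate f → T (f x)
∈-tabulate⁻ {f = f} {x} x∈ = Equivalence.from T-≡ (trans (sym (lookup∘tabulate f x)) ([]=⇒lookup x∈))

⟦_⟧ : ∀ {n} {P : Fin n → Set} → Decidable P → Subset n
⟦ P? ⟧ = tabulate (isYes ∘ P?)

module _ {n} {P : Fin n → Set} {P? : Decidable P} where

  ∈⟦⟧⁺ : ∀ {x} → P x → x ∈ ⟦ P? ⟧
  ∈⟦⟧⁺ {x} px = ∈-tabulate⁺ (fromWitness {a? = P? x} px)

  ∈⟦⟧⁻ : ∀ {x} → x ∈ ⟦ P? ⟧ → P x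
  ∈⟦⟧⁻ {x} x∈ = toWitness {a? = P? x} (∈-tabulate⁻ x∈)

∉⟦¬⟧⁻ : ∀ {n} {P : Fin n → Set} {P? : Decidable P} {x} → x ∉ ⟦ ¬? ∘ P? ⟧ → P x
∉⟦¬⟧⁻ {P? = P?} {x} x∉ = decidable-stable (P? x) (x∉ ∘ ∈⟦⟧⁺)

𝟙 : ∀ {a} {A : Set a} → Dec A → ℕ
𝟙 a? = if does a? then 1 else 0

𝟙-cong : ∀ {a b} {A : Set a} {B : Set b} → (A → B) → (B → A) → (a? : Dec A) (b? : Dec B) → 𝟙 a? ≡ 𝟙 b?
𝟙-cong f g (yes a) (yes b) = refl
𝟙-cong f g (yes a) (no ¬b) = contradiction (f a) ¬b
𝟙-cong f g (no ¬a) (yes b) = contradiction (g b) ¬a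
𝟙-cong f g (no ¬a) (no ¬b) = refl

∣p∣≡∑𝟙 : ∀ {n} (p : Subset n) → ∣ p ∣ ≡ ∑[ i < n ] 𝟙 (i ∈? p)
∣p∣≡∑𝟙 [] = refl
∣p∣≡∑𝟙 (inside ∷ p) = cong suc (∣p∣≡∑𝟙 p)
∣p∣≡∑𝟙 (outside ∷ p) = ∣p∣≡∑𝟙 p

module _ {n} {P : Fin n → Set} (P? : Decidable P) where

  ∑𝟙-unique : ∃! _≡_ P → ∑[ i < n ] 𝟙 (P? i) ≡ 1
  ∑𝟙-unique (x , px , unique) = begin
    ∑[ i < n ] 𝟙 (P? i)      ≡⟨ sum-cong-≗ (λ i → 𝟙-cong (λ pi → subst (_∈ ⁅ x ⁆) (unique pi) (x∈⁅x⁆ x))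
                                                          (λ i∈ → subst P (sym (x∈⁅y⁆⇒x≡y x i∈)) px)
                                                          (P? i) (i ∈? ⁅ x ⁆)) ⟩
    ∑[ i < n ] 𝟙 (i ∈? ⁅ x ⁆) ≡⟨ ∣p∣≡∑𝟙 ⁅ x ⁆ ⟨
    ∣ ⁅ x ⁆ ∣                 ≡⟨ ∣⁅x⁆∣≡1 x ⟩
    1                         ∎
    where open ≡-Reasoning

  ∑𝟙-none : (∀ i → ¬ P i) → ∑[ i < n ] 𝟙 (P? i) ≡ 0
  ∑𝟙-none none = trans (sum-cong-≗ (λ i → 𝟙-cong (none i) (λ ()) (P? i) (no id))) (sum-replicate-zero n)

module _ {n} {R : Fin n → Fin n → Set} (R? : ∀ x y → Dec (R x y)) (p q : Subset n) where

  matching⇒∣p∣≡∣q∣ : (∀ {x} → x ∈ p → ∃! _≡_ λ y → y ∈ q × R x y) →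
                     (∀ {y} → y ∈ q → ∃! _≡_ λ x → x ∈ p × R x y) → ∣ p ∣ ≡ ∣ q ∣
  matching⇒∣p∣≡∣q∣ partner-of-p partner-of-q = begin
    ∣ p ∣                                   ≡⟨ ∣p∣≡∑𝟙 p ⟩
    ∑[ x < n ] 𝟙 (x ∈? p)                   ≡⟨ sum-cong-≗ row ⟨
    ∑[ x < n ] ∑[ y < n ] 𝟙 (edge? x y)     ≡⟨ ∑-comm (λ x y → 𝟙 (edge? x y)) ⟩
    ∑[ y < n ] ∑[ x < n ] 𝟙 (edge? x y)     ≡⟨ sum-cong-≗ column ⟩
    ∑[ y < n ] 𝟙 (y ∈? q)                   ≡⟨ ∣p∣≡∑𝟙 q ⟨
    ∣ q ∣                                   ∎
    where
    open ≡-Reasoning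
    edge? : ∀ x y → Dec (x ∈ p × y ∈ q × R x y)
    edge? x y = x ∈? p ×-dec y ∈? q ×-dec R? x y
    row : ∀ x → ∑[ y < n ] 𝟙 (edge? x y) ≡ 𝟙 (x ∈? p)
    row x = by-cases (x ∈? p)
      where
      by-cases : (x∈p? : Dec (x ∈ p)) → ∑[ y < n ] 𝟙 (edge? x y) ≡ 𝟙 x∈p?
      by-cases (yes x∈p) = let y , (y∈q , r) , unique = partner-of-p x∈p in
        ∑𝟙-unique (edge? x) (y , (x∈p , y∈q , r) , λ (_ , y′∈q , r′) → unique (y′∈q , r′))
      by-cases (no x∉p) = ∑𝟙-none (edge? x) (λ y e → x∉p (proj₁ e))
    column : ∀ y → ∑[ x < n ] 𝟙 (edge? x y) ≡ 𝟙 (y ∈? q)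
    column y = by-cases (y ∈? q)
      where
      by-cases : (y∈q? : Dec (y ∈ q)) → ∑[ x < n ] 𝟙 (edge? x y) ≡ 𝟙 y∈q?
      by-cases (yes y∈q) = let x , (x∈p , r) , unique = partner-of-q y∈q in
        ∑𝟙-unique (λ x → edge? x y) (x , (x∈p , y∈q , r) , λ (x′∈p , _ , r′) → unique (x′∈p , r′))
      by-cases (no y∉q) = ∑𝟙-none (λ x → edge? x y) (λ x e → y∉q (proj₁ (proj₂ e)))

module _ {a} {A : Set a} where

  cons : A → (ℕ → A) → ℕ → A
  cons x f zero = x
  cons x f (suc i) = f i

  append : ℕ → (ℕ → A) → A → ℕ → A
  append m f x i with i ≤? m
  ... | yes _ = f i
  ... | no _ = x

  append-≤ : ∀ {m f x i} → i ≤ m → append m f x i ≡ f i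
  append-≤ {m} {i = i} i≤m with i ≤? m
  ... | yes _ = refl
  ... | no i≰m = contradiction i≤m i≰m

  append-> : ∀ {m f x i} → m < i → append m f x i ≡ x
  append-> {m} {i = i} m<i with i ≤? m
  ... | yes i≤m = contradiction i≤m (<⇒≱ m<i)
  ... | no _ = refl

  append-all : ∀ {p} (P : A → Set p) {m f x} → (∀ {i} → i ≤ m → P (f i)) → P x → ∀ i → P (append m f x i)
  append-all P {m} Pf Px i with i ≤? m
  ... | yes i≤m = Pf i≤m
  ... | no _ = Px

  InjectiveOn : ℕ → (ℕ → A) → Set a
  InjectiveOn m f = ∀ {i j} → i ≤ m → j ≤ m → f i ≡ f j → i ≡ j

  injectiveOn-0 : ∀ {f} → InjectiveOn 0 f
  injectiveOn-0 i≤0 j≤0 _ = trans (n≤0⇒n≡0 i≤0) (sym (n≤0⇒n≡0 j≤0))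

  cons-injective : ∀ {m f x} → (∀ {i} → i ≤ m → f i ≢ x) → InjectiveOn m f → InjectiveOn (suc m) (cons x f)
  cons-injective avoid inj {zero} {zero} _ _ _ = refl
  cons-injective avoid inj {zero} {suc j} _ (s≤s j≤m) x≡fj = contradiction (sym x≡fj) (avoid j≤m)
  cons-injective avoid inj {suc i} {zero} (s≤s i≤m) _ fi≡x = contradiction fi≡x (avoid i≤m)
  cons-injective avoid inj {suc i} {suc j} (s≤s i≤m) (s≤s j≤m) fi≡fj = cong suc (inj i≤m j≤m fi≡fj)

  append-injective : ∀ {m f x} → (∀ {i} → i ≤ m → f i ≢ x) → InjectiveOn m f →
                     InjectiveOn (suc m) (append m f x)
  append-injective {m} avoid inj {i} {j} i≤1+m j≤1+m eq with i ≤? m | j ≤? m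
  ... | yes i≤m | yes j≤m = inj i≤m j≤m eq
  ... | yes i≤m | no _ = contradiction eq (avoid i≤m)
  ... | no _ | yes j≤m = contradiction (sym eq) (avoid j≤m)
  ... | no i≰m | no j≰m = trans (≤-antisym i≤1+m (≰⇒> i≰m)) (sym (≤-antisym j≤1+m (≰⇒> j≰m)))

module _ {n : ℕ} (G : Graph n) where

  infix 4 _~_
  _~_ : Fin n → Fin n → Set
  _~_ = Adj G

  ~-sym : ∀ {u v} → u ~ v → v ~ u
  ~-sym {u} {v} = subst T (Graph.sym G u v)

  ~-irrefl : ∀ {v} → ¬ v ~ v
  ~-irrefl {v} = subst T (irrefl G v)

  ~⇒≢ : ∀ {u v} → u ~ v → u ≢ v
  ~⇒≢ u~v refl = ~-irrefl u~v

  _~?_ : ∀ u v → Dec (u ~ v)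
  u ~? v = T? (adj G u v)

  ∈N⁺ : ∀ {v x} → v ~ x → x ∈ N G v
  ∈N⁺ = ∈-tabulate⁺

  ∈N⁻ : ∀ {v x} → x ∈ N G v → v ~ x
  ∈N⁻ = ∈-tabulate⁻

  ~⇒¬Isolated : ∀ {v x} → v ~ x → ¬ Isolated G v
  ~⇒¬Isolated v~x deg≡0 = contradiction (subst (1 ≤_) deg≡0 (x∈p⇒1≤∣p∣ (∈N⁺ v~x))) λ ()

  ¬Isolated⇒nbr : ∀ {v} → ¬ Isolated G v → ∃[ x ] v ~ x
  ¬Isolated⇒nbr {v} ¬iso with any? (v ~?_)
  ... | yes nbr = nbr
  ... | no none =
    contradiction (trans (cong ∣_∣ (Empty-unique λ (x , x∈N) → none (x , ∈N⁻ x∈N))) (∣⊥∣≡0 n)) ¬iso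

  leaf? : ∀ v → Dec (Leaf G v)
  leaf? v = deg G v ≟ℕ 1

  leaf-nbr-unique : ∀ {ℓ a b} → Leaf G ℓ → ℓ ~ a → ℓ ~ b → a ≡ b
  leaf-nbr-unique {ℓ} {a} {b} leaf ℓ~a ℓ~b = decidable-stable (a ≟ b) λ a≢b →
    <-irrefl (∣⁅x⁆∣≡1 a) (subst (∣ ⁅ a ⁆ ∣ <_) leaf
      (p⊂q⇒∣p∣<∣q∣ (⁅x⁆⊆p (∈N⁺ ℓ~a) , b , ∈N⁺ ℓ~b , a≢b ∘ sym ∘ x∈⁅y⁆⇒x≡y a)))

  second-nbr : ∀ {v a} → ¬ Leaf G v → v ~ a → ∃[ b ] v ~ b × b ≢ a
  second-nbr {v} {a} ¬leaf v~a with any? (λ b → v ~? b ×-dec ¬? (b ≟ a))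
  ... | yes (b , v~b , b≢a) = b , v~b , b≢a
  ... | no none = contradiction (≤-antisym (subst (_ ≤_) (∣⁅x⁆∣≡1 a) (p⊆q⇒∣p∣≤∣q∣ N⊆⁅a⁆))
                                           (x∈p⇒1≤∣p∣ (∈N⁺ v~a))) ¬leaf
    where
    N⊆⁅a⁆ : N G v ⊆ ⁅ a ⁆
    N⊆⁅a⁆ {x} x∈N = subst (_∈ ⁅ a ⁆) (sym (decidable-stable (x ≟ a) λ x≢a → none (x , ∈N⁻ x∈N , x≢a)))
                                      (x∈⁅x⁆ a)

  walk? : ∀ k u w → Dec (Walk G u w k)
  walk? zero u w = map′ (λ { refl → here }) (λ { here → refl }) (u ≟ w)
  walk? (suc k) u w = map′ (λ (x , u~x , p) → step u~x p) (λ { (step u~x p) → _ , u~x , p })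
                           (any? λ x → u ~? x ×-dec walk? k x w)

  closed-path⇒Cycle : ∀ (f : ℕ → Fin n) L → 2 ≤ L → (∀ {i} → i < L → f i ~ f (suc i)) → f L ~ f 0 →
                      InjectiveOn L f → Cycle G
  closed-path⇒Cycle f (suc zero) (s≤s ()) _ _ _
  closed-path⇒Cycle f (suc (suc m)) _ steps closing inj = record
    { m = m
    ; c = f ∘ toℕ
    ; inj = λ {i} {j} → toℕ-injective ∘ inj (≤-pred (toℕ<n i)) (≤-pred (toℕ<n j))
    ; consec = λ i → subst (λ k → f k ~ f (suc (toℕ i))) (sym (toℕ-inject₁ i)) (steps (toℕ<n i))
    ; close = subst (λ k → f k ~ f 0) (sym (toℕ-fromℕ (suc (suc m)))) closing
    }

  IsTDS? : Decidable (IsTDS G)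
  IsTDS? S = all? λ v → any? λ u → u ∈? S ×-dec u ~? v

  IsTDS-mono : ∀ {S S′} → S ⊆ S′ → IsTDS G S → IsTDS G S′
  IsTDS-mono S⊆S′ tds v = let u , u∈S , u~v = tds v in u , S⊆S′ u∈S , u~v

  minimal-TDS-within : ∀ {S} → IsTDS G S → ∃[ M ] IsMinimalTDS G M × M ⊆ S
  minimal-TDS-within {S} = shrink S (⊂-wellFounded S)
    where
    shrink : ∀ S → Acc _⊂_ S → IsTDS G S → ∃[ M ] IsMinimalTDS G M × M ⊆ S
    shrink S (acc smaller) tds with any? (λ x → x ∈? S ×-dec IsTDS? (S - x))
    ... | yes (x , x∈S , tds-x) =
      let M , minimal , M⊆S-x = shrink (S - x) (smaller (x∈p⇒p-x⊂p x∈S)) tds-x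
      in  M , minimal , ⊆-trans M⊆S-x (p─q⊆p S ⁅ x ⁆)
    ... | no irredundant = S , (tds , proper-subsets) , ⊆-refl
      where
      proper-subsets : ∀ S′ → S′ ⊂ S → ¬ IsTDS G S′
      proper-subsets S′ (S′⊆S , x , x∈S , x∉S′) tds′ = irredundant (x , x∈S , IsTDS-mono S′⊆S-x tds′)
        where
        S′⊆S-x : S′ ⊆ S - x
        S′⊆S-x y∈S′ = x∈p∧x≢y⇒x∈p-y (S′⊆S y∈S′) λ { refl → x∉S′ y∈S′ }

  minimal⇒irredundant : ∀ {S x} → IsMinimalTDS G S → x ∈ S → ¬ IsTDS G (S - x)
  minimal⇒irredundant {S} {x} (_ , minimal) x∈S = minimal (S - x) (x∈p⇒p-x⊂p x∈S)

  remove-TDS : ∀ {S x} → IsTDS G S → (∀ {z} → x ~ z → ∃[ t ] t ∈ S - x × t ~ z) → IsTDS G (S - x)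
  remove-TDS {S} {x} tds replace z with tds z
  ... | t , t∈S , t~z with t ≟ x
  ...   | yes refl = replace t~z
  ...   | no t≢x = t , x∈p∧x≢y⇒x∈p-y t∈S t≢x , t~z

  forced-member : ∀ {M S z b} → IsTDS G M → M ⊆ S → (∀ {t} → t ∈ S → t ~ z → t ≡ b) → b ∈ M
  forced-member {z = z} tds M⊆S only-b = let t , t∈M , t~z = tds z in subst (_∈ _) (only-b (M⊆S t∈M) t~z) t∈M

  forced-by-exclusion : ∀ {P : Fin n → Set} (P? : Decidable P) {M z b} → IsTDS G M → M ⊆ ⟦ ¬? ∘ P? ⟧ →
                        (∀ {t} → z ~ t × t ≢ b → P t) → b ∈ M
  forced-by-exclusion _ tds M⊆S excluded = forced-member tds M⊆S λ {t} t∈S t~z →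
    decidable-stable (t ≟ _) λ t≢b → ∈⟦⟧⁻ t∈S (excluded (~-sym t~z , t≢b))

  WTD⇒minimal-is-minimum : ∀ {M S} → WTD G → IsMinimalTDS G M → IsTDS G S → ∣ M ∣ ≤ ∣ S ∣
  WTD⇒minimal-is-minimum {M} {S} wtd minM tds =
    let M′ , minM′ , M′⊆S = minimal-TDS-within tds
    in  subst (_≤ ∣ S ∣) (wtd M′ M minM′ minM) (p⊆q⇒∣p∣≤∣q∣ M′⊆S)

  exchange : ∀ {M b₁ b₂ a} → WTD G → IsMinimalTDS G M → b₁ ∈ M → b₂ ∈ M → b₁ ≢ b₂ →
             (∀ {w} → b₁ ~ w ⊎ b₂ ~ w → a ~ w ⊎ ∃[ t ] t ∈ M - b₁ - b₂ × t ~ w) → ⊥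
  exchange {M} {b₁} {b₂} {a} wtd minM b₁∈M b₂∈M b₁≢b₂ replace =
    <⇒≱ ∣M′∣<∣M∣ (WTD⇒minimal-is-minimum wtd minM tds′)
    where
    M′ : Subset n
    M′ = (M - b₁ - b₂) ∪ ⁅ a ⁆
    covered : ∀ {w} → a ~ w ⊎ ∃[ t ] t ∈ M - b₁ - b₂ × t ~ w → ∃[ t ] t ∈ M′ × t ~ w
    covered (inj₁ a~w) = a , x∈p∪q⁺ (inj₂ (x∈⁅x⁆ a)) , a~w
    covered (inj₂ (t , t∈ , t~w)) = t , x∈p∪q⁺ (inj₁ t∈) , t~w
    tds′ : IsTDS G M′
    tds′ w with proj₁ minM w
    ... | t , t∈M , t~w with t ≟ b₁ | t ≟ b₂
    ...   | yes refl | _ = covered (replace (inj₁ t~w))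
    ...   | no _ | yes refl = covered (replace (inj₂ t~w))
    ...   | no t≢b₁ | no t≢b₂ = t , x∈p∪q⁺ (inj₁ (x∈p∧x≢y⇒x∈p-y (x∈p∧x≢y⇒x∈p-y t∈M t≢b₁) t≢b₂)) , t~w
    ∣M′∣<∣M∣ : ∣ M′ ∣ < ∣ M ∣
    ∣M′∣<∣M∣ = begin-strict
      ∣ M′ ∣                        ≤⟨ ∣p∪q∣≤∣p∣+∣q∣ (M - b₁ - b₂) ⁅ a ⁆ ⟩
      ∣ M - b₁ - b₂ ∣ + ∣ ⁅ a ⁆ ∣   ≡⟨ cong (∣ M - b₁ - b₂ ∣ +_) (∣⁅x⁆∣≡1 a) ⟩
      ∣ M - b₁ - b₂ ∣ + 1           ≡⟨ +-comm ∣ M - b₁ - b₂ ∣ 1 ⟩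
      suc ∣ M - b₁ - b₂ ∣           ≤⟨ x∈p⇒∣p-x∣<∣p∣ (x∈p∧x≢y⇒x∈p-y b₂∈M (b₁≢b₂ ∘ sym)) ⟩
      ∣ M - b₁ ∣                    <⟨ x∈p⇒∣p-x∣<∣p∣ b₁∈M ⟩
      ∣ M ∣                         ∎
      where open ≤-Reasoning

  private
    nearest-leaf : ∀ {v k} → ¬ Isolated G v → Height G v k →
      (∃[ w ] Leaf G w × Walk G v w k) × (∀ w j → Leaf G w → Walk G v w j → k ≤ j)
    nearest-leaf ¬iso (inj₁ (iso , _)) = contradiction iso ¬iso
    nearest-leaf ¬iso (inj₂ (_ , reach , min)) = reach , min

  Height-unique : ∀ {v a b} → Height G v a → Height G v b → a ≡ b
  Height-unique (inj₁ (_ , a≡0)) (inj₁ (_ , b≡0)) = trans a≡0 (sym b≡0)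
  Height-unique (inj₁ (iso , _)) (inj₂ (¬iso , _)) = contradiction iso ¬iso
  Height-unique (inj₂ (¬iso , _)) (inj₁ (iso , _)) = contradiction iso ¬iso
  Height-unique (inj₂ (_ , (w , leaf , p) , min)) (inj₂ (_ , (w′ , leaf′ , p′) , min′)) =
    ≤-antisym (min w′ _ leaf′ p′) (min′ w _ leaf p)

  Height-≤-suc : ∀ {u v a b} → u ~ v → Height G u a → Height G v b → a ≤ suc b
  Height-≤-suc u~v hu hv =
    let (w , leaf , p) , _ = nearest-leaf (~⇒¬Isolated (~-sym u~v)) hv
    in  proj₂ (nearest-leaf (~⇒¬Isolated u~v) hu) w _ leaf (step u~v p)

  Height-down : ∀ {v k} → Height G v (suc k) → ∃[ u ] v ~ u × Height G u k
  Height-down (inj₂ (_ , (w , leaf , step {x = u} v~u p) , min)) =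
    u , v~u , inj₂ (~⇒¬Isolated (~-sym v~u) , (w , leaf , p) ,
                    λ w′ j leaf′ p′ → ≤-pred (min w′ (suc j) leaf′ (step v~u p′)))

  Leaf⇒Height0 : ∀ {v} → Leaf G v → Height G v 0
  Leaf⇒Height0 {v} leaf =
    inj₂ ((λ deg≡0 → 0≢1+n (trans (sym deg≡0) leaf)) , (v , leaf , here) , λ _ _ _ _ → z≤n)

  Height0⇒Leaf : ∀ {v} → ¬ Isolated G v → Height G v 0 → Leaf G v
  Height0⇒Leaf ¬iso h with nearest-leaf ¬iso h
  ... | (w , leaf , here) , _ = leaf

  Height-exists : ∀ {ℓ} → Leaf G ℓ → Connected G → ∀ v → ¬ Isolated G v → ∃ (Height G v)
  Height-exists {ℓ} leaf conn v ¬iso =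
    let k , (w , leaf-w , p) , min = least reach? (ℓ , leaf , proj₂ (conn v ℓ))
    in  k , inj₂ (¬iso , (w , leaf-w , p) , λ w′ j leaf′ p′ → min (w′ , leaf′ , p′))
    where
    reach? : Decidable λ k → ∃[ w ] Leaf G w × Walk G v w k
    reach? k = any? λ w → leaf? w ×-dec walk? k v w

  -- Rooted trees

  module Rooted (conn : Connected G) (acyc : Acyclic G) (r : Fin n) where

    private
      distance : ∀ v → Σ[ m ∈ ℕ ] Walk G v r m × (∀ {j} → Walk G v r j → m ≤ j)
      distance v = least (λ k → walk? k v r) (proj₂ (conn v r))

    depth : Fin n → ℕ
    depth v = proj₁ (distance v)

    depth-walk : ∀ v → Walk G v r (depth v)
    depth-walk v = proj₁ (proj₂ (distance v))

    depth-min : ∀ {v j} → Walk G v r j → depth v ≤ j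
    depth-min {v} = proj₂ (proj₂ (distance v))

    depth-root : depth r ≡ 0
    depth-root = n≤0⇒n≡0 (depth-min here)

    depth≡0⇒root : ∀ {v} → depth v ≡ 0 → v ≡ r
    depth≡0⇒root {v} d≡0 with subst (Walk G v r) d≡0 (depth-walk v)
    ... | here = refl

    depth-≤-suc : ∀ {u v} → u ~ v → depth u ≤ suc (depth v)
    depth-≤-suc {v = v} u~v = depth-min (step u~v (depth-walk v))

    parent-of : ∀ {v k} → depth v ≡ suc k → ∃[ p ] p ~ v × depth p ≡ k
    parent-of {v} {k} d≡1+k with subst (Walk G v r) d≡1+k (depth-walk v)
    ... | step {x = p} v~p walk =
      p , ~-sym v~p , ≤-antisym (depth-min walk) (≤-pred (subst (_≤ _) d≡1+k (depth-≤-suc v~p)))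

    ≢-by-depth : ∀ {u v} → depth u < depth v → u ≢ v
    ≢-by-depth d<d refl = <-irrefl refl d<d

    -- A bridge at level d is a path between two distinct vertices of depth d that never rises above depth d.
    -- Lifting both ends to their parents closes a cycle or gives a bridge one level up, so none exists.
    record Bridge (d m : ℕ) : Set where
      field
        vertex      : ℕ → Fin n
        steps       : ∀ {i} → i < m → vertex i ~ vertex (suc i)
        injective   : InjectiveOn m vertex
        depth-start : depth (vertex 0) ≡ d
        depth-end   : depth (vertex m) ≡ d
        below       : ∀ {i} → i ≤ m → d ≤ depth (vertex i)

    bridge-cycle : ∀ {d m p} (B : Bridge (suc d) (suc m)) → p ~ Bridge.vertex B 0 →
                   p ~ Bridge.vertex B (suc m) → depth p ≡ d → Cycle G
    bridge-cycle {d} {m} {p} B p~start p~end dp =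
      closed-path⇒Cycle (cons p vertex) (suc (suc m)) (s≤s (s≤s z≤n))
        (λ { {zero} _ → p~start ; {suc i} i<m → steps (≤-pred i<m) })
        (~-sym p~end)
        (cons-injective (λ i≤m → ≢-by-depth (subst (_< _) (sym dp) (below i≤m)) ∘ sym) injective)
      where open Bridge B

    bridge-lift : ∀ {d m p q} (B : Bridge (suc d) m) → p ~ Bridge.vertex B 0 → q ~ Bridge.vertex B m →
                  depth p ≡ d → depth q ≡ d → p ≢ q → Bridge d (suc (suc m))
    bridge-lift {d} {m} {p} {q} B p~start q~end dp dq p≢q = record
      { vertex      = cons p vertex′
      ; steps       = λ { {zero} _ → subst (p ~_) (sym (vertex′-≤ z≤n)) p~start
                        ; {suc i} i< → step′ (≤-pred i<) }
      ; injective   = cons-injective (λ {i} _ → append-all (_≢ p) (λ i≤m → ≢-by-depth (deeper dp i≤m) ∘ sym)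
                                                           (p≢q ∘ sym) i)
                                     (append-injective (λ i≤m → ≢-by-depth (deeper dq i≤m) ∘ sym) injective)
      ; depth-start = dp
      ; depth-end   = trans (cong depth vertex′-end) dq
      ; below       = λ { {zero} _ → ≤-reflexive (sym dp)
                        ; {suc i} _ → append-all (λ v → d ≤ depth v) (λ i≤m → ≤-trans (n≤1+n d) (below i≤m))
                                                 (≤-reflexive (sym dq)) i }
      }
      where
      open Bridge B
      vertex′ : ℕ → Fin n
      vertex′ = append m vertex q
      vertex′-≤ : ∀ {i} → i ≤ m → vertex′ i ≡ vertex i
      vertex′-≤ = append-≤ {m = m} {f = vertex} {x = q}
      vertex′-end : vertex′ (suc m) ≡ q
      vertex′-end = append-> {m = m} {f = vertex} {x = q} ≤-refl
      deeper : ∀ {x i} → depth x ≡ d → i ≤ m → depth x < depth (vertex i)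
      deeper dx i≤m = subst (_< _) (sym dx) (below i≤m)
      step′ : ∀ {i} → i < suc m → vertex′ i ~ vertex′ (suc i)
      step′ i<1+m with m<1+n⇒m<n∨m≡n i<1+m
      ... | inj₁ i<m = subst₂ _~_ (sym (vertex′-≤ (<⇒≤ i<m))) (sym (vertex′-≤ i<m)) (steps i<m)
      ... | inj₂ refl = subst₂ _~_ (sym (vertex′-≤ ≤-refl)) (sym vertex′-end) (~-sym q~end)

    no-bridge : ∀ {d m} → Bridge d (suc m) → ⊥
    no-bridge {zero} B =
      0≢1+n (injective z≤n ≤-refl (trans (depth≡0⇒root depth-start) (sym (depth≡0⇒root depth-end))))
      where open Bridge B
    no-bridge {suc d} B with parent-of (Bridge.depth-start B) | parent-of (Bridge.depth-end B)
    ... | p , p~start , dp | q , q~end , dq with p ≟ q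
    ...   | yes refl = acyc (bridge-cycle B p~start q~end dp)
    ...   | no p≢q = no-bridge (bridge-lift B p~start q~end dp dq p≢q)

    depth-adj : ∀ {u v} → u ~ v → depth v ≡ suc (depth u) ⊎ depth u ≡ suc (depth v)
    depth-adj {u} {v} u~v with <-cmp (depth u) (depth v)
    ... | tri< du<dv _ _ = inj₁ (≤-antisym (depth-≤-suc (~-sym u~v)) du<dv)
    ... | tri> _ _ dv<du = inj₂ (≤-antisym (depth-≤-suc u~v) dv<du)
    ... | tri≈ _ du≡dv _ = ⊥-elim (no-bridge {m = 0} record
      { vertex      = cons u λ _ → v
      ; steps       = λ { {zero} _ → u~v ; {suc _} (s≤s ()) }
      ; injective   = cons-injective (λ _ → ~⇒≢ u~v ∘ sym) injectiveOn-0
      ; depth-start = refl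
      ; depth-end   = sym du≡dv
      ; below       = λ { {zero} _ → ≤-refl ; {suc _} _ → ≤-reflexive du≡dv }
      })

    Child : Fin n → Fin n → Set
    Child p c = p ~ c × depth c ≡ suc (depth p)

    parent-unique : ∀ {p q v} → Child p v → Child q v → p ≡ q
    parent-unique {p} {q} {v} (p~v , dv) (q~v , dv′) =
      decidable-stable (p ≟ q) λ p≢q → no-bridge {m = 1} record
      { vertex      = cons p (cons v λ _ → q)
      ; steps       = λ { {zero} _ → p~v ; {suc zero} _ → ~-sym q~v ; {suc (suc _)} (s≤s (s≤s ())) }
      ; injective   = cons-injective (λ { {zero} _ → ≢-by-depth (≤-reflexive (sym dv)) ∘ sym
                                        ; {suc _} _ → p≢q ∘ sym })
                                     (cons-injective (λ _ → ≢-by-depth (≤-reflexive (sym dv′)))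
                                                     injectiveOn-0)
      ; depth-start = refl
      ; depth-end   = dq≡dp
      ; below       = λ { {zero} _ → ≤-refl ; {suc zero} _ → ≤-trans (n≤1+n _) (≤-reflexive (sym dv))
                        ; {suc (suc _)} _ → ≤-reflexive (sym dq≡dp) }
      }
      where
      dq≡dp : depth q ≡ depth p
      dq≡dp = suc-injective (trans (sym dv′) dv)

    adj⇒Child : ∀ {u v} → u ~ v → Child u v ⊎ Child v u
    adj⇒Child u~v = [ inj₁ ∘ (u~v ,_) , inj₂ ∘ (~-sym u~v ,_) ]′ (depth-adj u~v)

    nonroot-depth : ∀ {v} → v ≢ r → ∃[ k ] depth v ≡ suc k
    nonroot-depth {v} v≢r with depth v in dv
    ... | zero = contradiction (depth≡0⇒root dv) v≢r
    ... | suc k = k , refl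

    has-parent : ∀ {v} → v ≢ r → ∃[ p ] Child p v
    has-parent v≢r = let k , dv = nonroot-depth v≢r
                         p , p~v , dp = parent-of dv
                     in  p , p~v , trans dv (cong suc (sym dp))

    root-Child : ∀ {c} → r ~ c → Child r c
    root-Child r~c = [ id , (λ (_ , dr) → contradiction (trans (sym dr) depth-root) 1+n≢0) ]′ (adj⇒Child r~c)

    Child-step : ∀ {a b c} → Child a b → b ~ c → c ≢ a → Child b c
    Child-step ab b~c c≢a = [ id , (λ cb → contradiction (parent-unique cb ab) c≢a) ]′ (adj⇒Child b~c)

    has-child : ∀ {v} → v ≢ r → ¬ Leaf G v → ∃[ c ] Child v c
    has-child v≢r ¬leaf =
      let p , pv = has-parent v≢r
          c , v~c , c≢p = second-nbr ¬leaf (~-sym (proj₁ pv))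
      in  c , Child-step pv v~c c≢p

    Child-depth : ∀ {p c k} → Child p c → depth p ≡ k → depth c ≡ suc k
    Child-depth (_ , dc) dp = trans dc (cong suc dp)

    ¬adj-far : ∀ {u v i j} → depth u ≡ i → depth v ≡ j → suc (suc i) ≤ j → ¬ u ~ v
    ¬adj-far du dv far u~v =
      <-irrefl refl (≤-trans (subst₂ (λ i j → suc (suc i) ≤ j) (sym du) (sym dv) far)
                             (depth-≤-suc (~-sym u~v)))

    ≢-depths : ∀ {u v i j} → depth u ≡ i → depth v ≡ j → i ≢ j → u ≢ v
    ≢-depths du dv i≢j refl = i≢j (trans (sym du) dv)

    private
      parent-at : ∀ v k → depth v ≡ k → Fin n
      parent-at v zero _ = v
      parent-at v (suc k) dv = proj₁ (parent-of dv)

    -- The root is its own parent.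
    parent : Fin n → Fin n
    parent v = parent-at v (depth v) refl

    parent-Child : ∀ {p v} → Child p v → parent v ≡ p
    parent-Child {p} {v} pv = at (depth v) refl
      where
      at : ∀ k (dv : depth v ≡ k) → parent-at v k dv ≡ p
      at zero dv = contradiction (trans (sym dv) (proj₂ pv)) 0≢1+n
      at (suc k) dv = let q , q~v , dq = parent-of dv in parent-unique (q~v , trans dv (cong suc (sym dq))) pv

    ancestor : ℕ → Fin n → Fin n
    ancestor zero v = v
    ancestor (suc i) v = ancestor i (parent v)

    -- The child of r on the path from r to v (r itself when v = r).
    branch : Fin n → Fin n
    branch v = ancestor (depth v ∸ 1) v

    branch-root-Child : ∀ {c} → Child r c → branch c ≡ c
    branch-root-Child rc = cong (λ k → ancestor (k ∸ 1) _) (Child-depth rc depth-root)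

    branch-Child : ∀ {p c} → Child p c → p ≢ r → branch c ≡ branch p
    branch-Child {p} {c} pc p≢r = let k , dp = nonroot-depth p≢r in begin
      ancestor (depth c ∸ 1) c     ≡⟨ cong (λ j → ancestor (j ∸ 1) c) (Child-depth pc dp) ⟩
      ancestor k (parent c)        ≡⟨ cong (ancestor k) (parent-Child pc) ⟩
      ancestor k p                 ≡⟨ cong (λ j → ancestor (j ∸ 1) p) dp ⟨
      ancestor (depth p ∸ 1) p     ∎
      where open ≡-Reasoning

    TDS-from-parents : ∀ {S} → (∃[ t ] t ∈ S × t ~ r) →
                       (∀ {p w} → Child p w → p ∉ S → ∃[ t ] t ∈ S × t ~ w) → IsTDS G S
    TDS-from-parents {S} root-covered cover w with w ≟ r
    ... | yes refl = root-covered
    ... | no w≢r with has-parent w≢r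
    ...   | p , pw with p ∈? S
    ...     | yes p∈S = p , p∈S , proj₁ pw
    ...     | no p∉S = cover pw p∉S

    dominated-by-child : ∀ {S w} → w ≢ r → ¬ Leaf G w → (∀ {c} → Child w c → c ∈ S) → ∃[ t ] t ∈ S × t ~ w
    dominated-by-child w≢r ¬leaf children∈S =
      let c , wc = has-child w≢r ¬leaf in c , children∈S wc , ~-sym (proj₁ wc)

    parent-forced : ∀ {M S g p} → IsTDS G M → M ⊆ S → Child g p → (∀ {t} → Child p t → t ∉ S) → g ∈ M
    parent-forced tds M⊆S gp children∉S = forced-member tds M⊆S λ t∈S t~p →
      [ (λ tp → parent-unique tp gp) , (λ pt → contradiction t∈S (children∉S pt)) ]′ (adj⇒Child t~p)

  leaf-exists : Connected G → Acyclic G → ∀ {u v} → u ~ v → ∃ (Leaf G)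
  leaf-exists conn acyc {u} {v} u~v = deepest , decidable-stable (leaf? deepest) λ ¬leaf →
    let c , _ , dc = has-child deepest≢u ¬leaf in <-irrefl refl (subst (_≤ _) dc (is-deepest c))
    where
    open Rooted conn acyc u
    deepest : Fin n
    deepest = argmax depth u (allFin n)
    is-deepest : ∀ x → depth x ≤ depth deepest
    is-deepest x = All.lookup (f[xs]≤f[argmax] u (allFin n)) (∈-allFin x)
    deepest≢u : deepest ≢ u
    deepest≢u deepest≡u = contradiction (subst₂ _≤_ (Child-depth (root-Child u~v) depth-root)
                                                    (trans (cong depth deepest≡u) depth-root) (is-deepest v)) λ ()

  Height-total : Connected G → Acyclic G → ∀ v → ∃ (Height G v)
  Height-total conn acyc v with deg G v ≟ℕ 0
  ... | yes iso = 0 , inj₁ (iso , refl)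
  ... | no ¬iso = let _ , v~x = ¬Isolated⇒nbr ¬iso
                      _ , leaf = leaf-exists conn acyc v~x
                  in  Height-exists leaf conn v ¬iso

  module BalancedTree (conn : Connected G) (acyc : Acyclic G) (bal : Balanced G) where

    h : Fin n → ℕ
    h v = proj₁ (Height-total conn acyc v)

    Height-h : ∀ v → Height G v (h v)
    Height-h v = proj₂ (Height-total conn acyc v)

    Height⇒h : ∀ {v k} → Height G v k → h v ≡ k
    Height⇒h = Height-unique (Height-h _)

    h⇒Height : ∀ {v k} → h v ≡ k → Height G v k
    h⇒Height {v} hv = subst (Height G v) hv (Height-h v)

    h-adj : ∀ {u v} → u ~ v → h v ≡ suc (h u) ⊎ h u ≡ suc (h v)
    h-adj {u} {v} u~v with <-cmp (h u) (h v)
    ... | tri< hu<hv _ _ = inj₁ (≤-antisym (Height-≤-suc (~-sym u~v) (Height-h v) (Height-h u)) hu<hv)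
    ... | tri> _ _ hv<hu = inj₂ (≤-antisym (Height-≤-suc u~v (Height-h u) (Height-h v)) hv<hu)
    ... | tri≈ _ hu≡hv _ = ⊥-elim (bal u v (h u) u~v (Height-h u) (h⇒Height (sym hu≡hv)))

    ≢-heights : ∀ {u v i j} → h u ≡ i → h v ≡ j → i ≢ j → u ≢ v
    ≢-heights hu hv i≢j refl = i≢j (trans (sym hu) hv)

    h-adj-≢ : ∀ {u v} → u ~ v → h u ≢ h v
    h-adj-≢ u~v hu≡hv =
      [ (λ hv → 1+n≢n (trans (sym hv) (sym hu≡hv))) , (λ hu → 1+n≢n (trans (sym hu) hu≡hv)) ]′ (h-adj u~v)

    Leaf⇒h≡0 : ∀ {v} → Leaf G v → h v ≡ 0
    Leaf⇒h≡0 = Height⇒h ∘ Leaf⇒Height0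

    h≡0⇒Leaf : ∀ {v x} → v ~ x → h v ≡ 0 → Leaf G v
    h≡0⇒Leaf v~x = Height0⇒Leaf (~⇒¬Isolated v~x) ∘ h⇒Height

    h-down : ∀ {v k} → h v ≡ suc k → ∃[ u ] v ~ u × h u ≡ k
    h-down hv = let u , v~u , hu = Height-down (h⇒Height hv) in u , v~u , Height⇒h hu

    leaf-support : ∀ {ℓ x} → Leaf G ℓ → x ~ ℓ → h x ≡ 1
    leaf-support leaf x~ℓ = [ (λ hℓ → contradiction (trans (sym hℓ) (Leaf⇒h≡0 leaf)) 1+n≢0) ,
                              (λ hx → trans hx (cong suc (Leaf⇒h≡0 leaf))) ]′ (h-adj x~ℓ)

    h≡1⇒support : ∀ {x} → h x ≡ 1 → ∃[ ℓ ] x ~ ℓ × Leaf G ℓ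
    h≡1⇒support hx = let ℓ , x~ℓ , hℓ = h-down hx in ℓ , x~ℓ , h≡0⇒Leaf (~-sym x~ℓ) hℓ

    no-leaf-below : ∀ {p w} → h p ≢ 1 → p ~ w → ¬ Leaf G w
    no-leaf-below hp≢1 p~w leaf = hp≢1 (leaf-support leaf p~w)

    h-≤-suc : ∀ {u v} → u ~ v → h u ≤ suc (h v)
    h-≤-suc u~v = Height-≤-suc u~v (Height-h _) (Height-h _)

    h-lower-bound : ∀ {u v k} → suc k ≤ h u → u ~ v → k ≤ h v
    h-lower-bound k<hu u~v = ≤-pred (≤-trans k<hu (h-≤-suc u~v))

    h>0⇒¬Leaf : ∀ {v} → 0 < h v → ¬ Leaf G v
    h>0⇒¬Leaf 0<hv leaf = <-irrefl (sym (Leaf⇒h≡0 leaf)) 0<hv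

    h≡suc⇒¬Leaf : ∀ {v k} → h v ≡ suc k → ¬ Leaf G v
    h≡suc⇒¬Leaf hv = h>0⇒¬Leaf (subst (0 <_) (sym hv) (s≤s z≤n))

    no-support-nbr : ∀ {p t} → h p ≡ 1 ⊎ 3 ≤ h p → p ~ t → h t ≢ 1
    no-support-nbr (inj₁ hp) p~t ht = h-adj-≢ p~t (trans hp (sym ht))
    no-support-nbr (inj₂ 3≤hp) p~t ht = contradiction (h-lower-bound 3≤hp p~t) λ 2≤ht → <-irrefl (sym ht) 2≤ht

    heights-downward-closed : ∀ {v j} k → h v ≡ j + k → ∃[ x ] h x ≡ j
    heights-downward-closed {v} zero hv = v , trans hv (+-identityʳ _)
    heights-downward-closed {v} {j} (suc k) hv =
      let u , _ , hu = h-down (trans hv (+-suc j k)) in heights-downward-closed k hu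

    -- Once the children of p are excluded, g is forced into the TDS and dominates c in place of r.
    Guarded : Fin n → Fin n → Set
    Guarded r c = ∃₂ λ g p → c ~ g × g ~ p × g ≢ r × p ≢ c × (∀ {t} → p ~ t → h t ≢ 1)

    guarded-via-V₂ : ∀ {r c g} → c ~ g → g ≢ r → h c ≡ 3 → h g ≡ 2 → Guarded r c
    guarded-via-V₂ c~g g≢r hc hg = let p , g~p , hp = h-down hg in
      _ , p , c~g , g~p , g≢r , ≢-heights hp hc (λ ()) , no-support-nbr (inj₁ hp)

    guarded-high : ∀ {r c} → 5 ≤ h c → r ~ c → Guarded r c
    guarded-high {r} {c} 5≤hc r~c with second-nbr (h>0⇒¬Leaf (≤-trans (s≤s z≤n) 5≤hc)) (~-sym r~c)
    ... | g , c~g , g≢r with second-nbr (h>0⇒¬Leaf (≤-trans (s≤s z≤n) (h-lower-bound 5≤hc c~g))) (~-sym c~g)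
    ...   | p , g~p , p≢c = g , p , c~g , g~p , g≢r , p≢c ,
                            no-support-nbr (inj₂ (h-lower-bound (h-lower-bound 5≤hc c~g) g~p))

    V₁ : Subset n
    V₁ = ⟦ (λ v → h v ≟ℕ 1) ⟧

    support∈TDS : ∀ {S u} → IsTDS G S → h u ≡ 1 → u ∈ S
    support∈TDS {S} tds hu =
      let ℓ , u~ℓ , leaf = h≡1⇒support hu
          t , t∈S , t~ℓ = tds ℓ
      in  subst (_∈ S) (leaf-nbr-unique leaf (~-sym t~ℓ) (~-sym u~ℓ)) t∈S

    module _ (c1 : Cond1 G) where

      h≤3 : ∀ v → h v ≤ 3
      h≤3 v = c1 v (h v) (Height-h v)

      V₃-nbr : ∀ {x b} → h x ≡ 3 → x ~ b → h b ≡ 2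
      V₃-nbr {b = b} hx x~b =
        [ (λ hb → contradiction (subst (_≤ 3) (trans hb (cong suc hx)) (h≤3 b)) λ { (s≤s (s≤s (s≤s ()))) }) ,
          (λ hx′ → suc-injective (trans (sym hx′) hx)) ]′ (h-adj x~b)

    module _ (c2 : Cond2 G) where

      V₂-support-unique : ∀ {x a b} → h x ≡ 2 → x ~ a → h a ≡ 1 → x ~ b → h b ≡ 1 → a ≡ b
      V₂-support-unique hx x~a ha x~b hb = let _ , _ , _ , unique = c2 _ (h⇒Height hx) in
        trans (unique _ x~a (h⇒Height ha)) (sym (unique _ x~b (h⇒Height hb)))

      V₂-other-nbr : ∀ {x a b} → h x ≡ 2 → x ~ a → h a ≡ 1 → x ~ b → b ≢ a → h b ≡ 3
      V₂-other-nbr hx x~a ha x~b b≢a =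
        [ (λ hb → trans hb (cong suc hx)) ,
          (λ hx′ → contradiction (V₂-support-unique hx x~b (suc-injective (trans (sym hx′) hx)) x~a ha) b≢a) ]′
        (h-adj x~b)

  -- Well-totally dominated balanced trees satisfy (1)–(3)

  module _ (conn : Connected G) (acyc : Acyclic G) (bal : Balanced G) (wtd : WTD G) where
    open BalancedTree conn acyc bal

    module _ {v u u′ ℓ ℓ′ : Fin n} (v~u : v ~ u) (v~u′ : v ~ u′) (u≢u′ : u ≢ u′)
             (u~ℓ : u ~ ℓ) (u′~ℓ′ : u′ ~ ℓ′) (leaf : Leaf G ℓ) (leaf′ : Leaf G ℓ′) where
      open Rooted conn acyc v

      private
        hu : h u ≡ 1
        hu = leaf-support leaf u~ℓ
        hu′ : h u′ ≡ 1
        hu′ = leaf-support leaf′ u′~ℓ′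

        ℓ≢ℓ′ : ℓ ≢ ℓ′
        ℓ≢ℓ′ refl = u≢u′ (leaf-nbr-unique leaf (~-sym u~ℓ) (~-sym u′~ℓ′))

        Bad : Fin n → Set
        Bad t = (u ~ t × t ≢ ℓ) ⊎ (u′ ~ t × t ≢ ℓ′)

        Bad? : Decidable Bad
        Bad? t = (u ~? t ×-dec ¬? (t ≟ ℓ)) ⊎-dec (u′ ~? t ×-dec ¬? (t ≟ ℓ′))

        S : Subset n
        S = ⟦ ¬? ∘ Bad? ⟧

        depth-1 : ∀ {x} → v ~ x → depth x ≡ 1
        depth-1 v~x = Child-depth (root-Child v~x) depth-root

        u∈S : u ∈ S
        u∈S = ∈⟦⟧⁺ [ ~-irrefl ∘ proj₁ , (λ (u′~u , _) → h-adj-≢ u′~u (trans hu′ (sym hu))) ]′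

        ℓ∈S : ℓ ∈ S
        ℓ∈S = ∈⟦⟧⁺ [ (λ (_ , ℓ≢ℓ) → ℓ≢ℓ refl) ,
                     (λ (u′~ℓ , _) → u≢u′ (leaf-nbr-unique leaf (~-sym u~ℓ) (~-sym u′~ℓ))) ]′

        ℓ′∈S : ℓ′ ∈ S
        ℓ′∈S = ∈⟦⟧⁺ [ (λ (u~ℓ′ , _) → u≢u′ (leaf-nbr-unique leaf′ (~-sym u~ℓ′) (~-sym u′~ℓ′))) ,
                      (λ (_ , ℓ′≢ℓ′) → ℓ′≢ℓ′ refl) ]′

        deep∈S : ∀ {c} → 3 ≤ depth c → c ∈ S
        deep∈S 3≤dc =
          ∈⟦⟧⁺ [ ¬adj-far (depth-1 v~u) refl 3≤dc ∘ proj₁ , ¬adj-far (depth-1 v~u′) refl 3≤dc ∘ proj₁ ]′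

        root-child-covered : ∀ {w} → v ~ w → ∃[ t ] t ∈ S × t ~ w
        root-child-covered {w} v~w with w ≟ u | w ≟ u′
        ... | yes refl | _ = ℓ , ℓ∈S , ~-sym u~ℓ
        ... | no _ | yes refl = ℓ′ , ℓ′∈S , ~-sym u′~ℓ′
        ... | no w≢u | no w≢u′ = dominated-by-child (~⇒≢ v~w ∘ sym) (no-leaf-below hv≢1 v~w) λ wc →
              ∈⟦⟧⁺ [ w≢u ∘ sym ∘ same-parent wc v~u ∘ proj₁ , w≢u′ ∘ sym ∘ same-parent wc v~u′ ∘ proj₁ ]′
          where
          hv≢1 : h v ≢ 1
          hv≢1 hv = h-adj-≢ v~u (trans hv (sym hu))
          same-parent : ∀ {x c} → Child w c → v ~ x → x ~ c → x ≡ w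
          same-parent wc v~x x~c =
            parent-unique (x~c , trans (proj₂ wc) (cong suc (trans (depth-1 v~w) (sym (depth-1 v~x))))) wc

        below-support : ∀ {x p w} → v ~ x → h x ≡ 1 → x ~ p → Child p w → ∃[ t ] t ∈ S × t ~ w
        below-support {x} {p} {w} v~x hx x~p pw with adj⇒Child x~p
        ... | inj₂ px rewrite parent-unique px (root-Child v~x) = root-child-covered (proj₁ pw)
        ... | inj₁ xp =
          dominated-by-child (≢-depths dw depth-root λ ())
                             (no-leaf-below (λ hp → h-adj-≢ x~p (trans hx (sym hp))) (proj₁ pw))
                             λ wc → deep∈S (≤-trans (n≤1+n 3) (≤-reflexive (sym (Child-depth wc dw))))
          where
          dw : depth w ≡ 3
          dw = Child-depth pw (Child-depth xp (depth-1 v~x))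

        S-TDS : IsTDS G S
        S-TDS = TDS-from-parents (u , u∈S , ~-sym v~u) λ pw p∉S →
          [ (λ (u~p , _) → below-support v~u hu u~p pw) , (λ (u′~p , _) → below-support v~u′ hu′ u′~p pw) ]′
          (∉⟦¬⟧⁻ {P? = Bad?} p∉S)

      two-support-nbrs⇒¬WTD : ⊥
      two-support-nbrs⇒¬WTD with minimal-TDS-within S-TDS
      ... | M , minM , M⊆S =
        exchange wtd minM (forced-by-exclusion Bad? (proj₁ minM) M⊆S inj₁)
                          (forced-by-exclusion Bad? (proj₁ minM) M⊆S inj₂) ℓ≢ℓ′ replace
        where
        replace : ∀ {w} → ℓ ~ w ⊎ ℓ′ ~ w → v ~ w ⊎ ∃[ t ] t ∈ M - ℓ - ℓ′ × t ~ w
        replace (inj₁ ℓ~w) = inj₁ (subst (v ~_) (leaf-nbr-unique leaf (~-sym u~ℓ) ℓ~w) v~u)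
        replace (inj₂ ℓ′~w) = inj₁ (subst (v ~_) (leaf-nbr-unique leaf′ (~-sym u′~ℓ′) ℓ′~w) v~u′)

    module _ {r s a q ℓ : Fin n} (r~s : r ~ s) (s~a : s ~ a) (a~q : a ~ q) (q~ℓ : q ~ ℓ) (a≢r : a ≢ r)
             (hs : h s ≡ 3) (ha : h a ≡ 2) (hq : h q ≡ 1) (leaf : Leaf G ℓ)
             (guard : ∀ {c} → r ~ c → c ≢ s → Guarded r c) where
      open Rooted conn acyc r

      private
        rs : Child r s
        rs = root-Child r~s
        sa : Child s a
        sa = Child-step rs s~a a≢r
        aq : Child a q
        aq = Child-step sa a~q (≢-heights hq hs λ ())
        qℓ : Child q ℓ
        qℓ = Child-step aq q~ℓ (≢-heights (Leaf⇒h≡0 leaf) ha λ ())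
        ds : depth s ≡ 1
        ds = Child-depth rs depth-root
        da : depth a ≡ 2
        da = Child-depth sa ds
        dq : depth q ≡ 3
        dq = Child-depth aq da
        dℓ : depth ℓ ≡ 4
        dℓ = Child-depth qℓ dq
        s≢r : s ≢ r
        s≢r = ≢-depths ds depth-root λ ()
        ba : branch a ≡ s
        ba = trans (branch-Child sa s≢r) (branch-root-Child rs)

        -- The exclusions force r (via s), ℓ (via q), and the vertex g of every guarded sibling branch.
        Bad : Fin n → Set
        Bad t = (s ~ t × t ≢ r) ⊎ (q ~ t × t ≢ ℓ) ⊎ (depth t ≡ 4 × h t ≢ 1 × branch t ≢ s)

        Bad? : Decidable Bad
        Bad? t = (s ~? t ×-dec ¬? (t ≟ r)) ⊎-dec (q ~? t ×-dec ¬? (t ≟ ℓ))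
                 ⊎-dec (depth t ≟ℕ 4 ×-dec ¬? (h t ≟ℕ 1) ×-dec ¬? (branch t ≟ s))

        S : Subset n
        S = ⟦ ¬? ∘ Bad? ⟧

        s∈S : s ∈ S
        s∈S = ∈⟦⟧⁺ [ ~-irrefl ∘ proj₁ , [ ¬adj-far ds dq ≤-refl ∘ ~-sym ∘ proj₁ ,
                                          (λ (d , _) → contradiction (trans (sym ds) d) λ ()) ]′ ]′

        ℓ∈S : ℓ ∈ S
        ℓ∈S = ∈⟦⟧⁺ [ ¬adj-far ds dℓ (s≤s (s≤s (s≤s z≤n))) ∘ proj₁ ,
                     [ (λ (_ , ℓ≢ℓ) → ℓ≢ℓ refl) , (λ (_ , _ , bℓ≢s) → bℓ≢s bℓ) ]′ ]′
          where
          bℓ : branch ℓ ≡ s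
          bℓ = trans (branch-Child qℓ (≢-depths dq depth-root λ ()))
                     (trans (branch-Child aq (≢-depths da depth-root λ ())) ba)

        deep∈S : ∀ {c} → 5 ≤ depth c → c ∈ S
        deep∈S 5≤dc = ∈⟦⟧⁺ [ ¬adj-far ds refl (≤-trans (s≤s (s≤s (s≤s z≤n))) 5≤dc) ∘ proj₁ ,
                             [ ¬adj-far dq refl 5≤dc ∘ proj₁ ,
                               (λ (d , _) → <-irrefl (sym d) 5≤dc) ]′ ]′

        below-q-level∈S : ∀ {w c} → Child w c → depth w ≡ 3 → branch w ≡ s → w ≢ q → c ∈ S
        below-q-level∈S {w} {c} wc dw bw w≢q = ∈⟦⟧⁺
          [ ¬adj-far ds (Child-depth wc dw) (s≤s (s≤s (s≤s z≤n))) ∘ proj₁ ,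
            [ (λ (q~c , _) → w≢q (parent-unique wc (q~c , trans (Child-depth wc dw) (cong suc (sym dq))))) ,
              (λ (_ , _ , bc≢s) → bc≢s (trans (branch-Child wc (≢-depths dw depth-root λ ())) bw)) ]′ ]′

        middle : ∀ {p w} → Child p w → depth p ≡ 2 → branch p ≡ s → h p ≢ 1 → ∃[ t ] t ∈ S × t ~ w
        middle {p} {w} pw dp bp hp≢1 with w ≟ q
        ... | yes refl = ℓ , ℓ∈S , ~-sym q~ℓ
        ... | no w≢q = dominated-by-child (≢-depths dw depth-root λ ()) (no-leaf-below hp≢1 (proj₁ pw)) λ wc →
                         below-q-level∈S wc dw (trans (branch-Child pw (≢-depths dp depth-root λ ())) bp) w≢q
          where
          dw : depth w ≡ 3
          dw = Child-depth pw dp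

        deep : ∀ {p w} → Child p w → 4 ≤ depth p → h p ≢ 1 → ∃[ t ] t ∈ S × t ~ w
        deep {p} {w} pw 4≤dp hp≢1 =
          dominated-by-child (≢-by-depth (subst₂ _<_ (sym depth-root) (sym (proj₂ pw)) (s≤s z≤n)) ∘ sym)
                     (no-leaf-below hp≢1 (proj₁ pw))
                     λ wc → deep∈S (≤-trans (n≤1+n 5)
                                             (subst (6 ≤_) (sym (Child-depth wc (proj₂ pw))) (s≤s (s≤s 4≤dp))))

        S-TDS : IsTDS G S
        S-TDS = TDS-from-parents (s , s∈S , ~-sym r~s) λ {p} pw p∉S → case p (∉⟦¬⟧⁻ {P? = Bad?} p∉S) pw
          where
          case : ∀ p {w} → Bad p → Child p w → ∃[ t ] t ∈ S × t ~ w
          case p (inj₁ (s~p , p≢r)) pw =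
            let sp = Child-step rs s~p p≢r
            in  middle pw (Child-depth sp ds) (trans (branch-Child sp s≢r) (branch-root-Child rs))
                       (no-support-nbr (inj₂ (≤-reflexive (sym hs))) s~p)
          case p (inj₂ (inj₁ (q~p , p≢ℓ))) pw with adj⇒Child q~p
          ... | inj₁ qp = deep pw (≤-reflexive (sym (Child-depth qp dq))) (h-adj-≢ q~p ∘ trans hq ∘ sym)
          ... | inj₂ pq rewrite parent-unique pq aq =
            middle pw da ba (λ ha≡1 → contradiction (trans (sym ha) ha≡1) λ ())
          case p (inj₂ (inj₂ (dp , hp≢1 , _))) pw = deep pw (≤-reflexive (sym dp)) hp≢1

        guarded : ∀ {M c} → IsTDS G M → M ⊆ S → r ~ c → c ≢ s → ∃[ g ] g ∈ M - r - ℓ × g ~ c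
        guarded {M} {c} tdsM M⊆S r~c c≢s with guard r~c c≢s
        ... | g , p , c~g , g~p , g≢r , p≢c , no-support =
          g , x∈p∧x≢y⇒x∈p-y (x∈p∧x≢y⇒x∈p-y g∈M g≢r) (≢-depths dg dℓ λ ()) , ~-sym c~g
          where
          rc : Child r c
          rc = root-Child r~c
          cg : Child c g
          cg = Child-step rc c~g g≢r
          gp : Child g p
          gp = Child-step cg g~p p≢c
          dc : depth c ≡ 1
          dc = Child-depth rc depth-root
          dg : depth g ≡ 2
          dg = Child-depth cg dc
          dp : depth p ≡ 3
          dp = Child-depth gp dg
          bp : branch p ≡ c
          bp = trans (branch-Child gp (≢-depths dg depth-root λ ()))
                     (trans (branch-Child cg (≢-depths dc depth-root λ ())) (branch-root-Child rc))
          g∈M : g ∈ M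
          g∈M = parent-forced tdsM M⊆S gp λ pt t∈S → ∈⟦⟧⁻ t∈S (inj₂ (inj₂
            (Child-depth pt dp , no-support (proj₁ pt) ,
             λ bt≡s → c≢s (trans (sym bp)
                                 (trans (sym (branch-Child pt (≢-depths dp depth-root λ ()))) bt≡s)))))

      guarded-chain⇒¬WTD : ⊥
      guarded-chain⇒¬WTD with minimal-TDS-within S-TDS
      ... | M , minM , M⊆S =
        exchange wtd minM (forced-by-exclusion Bad? (proj₁ minM) M⊆S inj₁)
                          (forced-by-exclusion Bad? (proj₁ minM) M⊆S (inj₂ ∘ inj₁))
                          (≢-depths depth-root dℓ λ ()) replace
        where
        replace : ∀ {w} → r ~ w ⊎ ℓ ~ w → a ~ w ⊎ ∃[ t ] t ∈ M - r - ℓ × t ~ w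
        replace {w} (inj₁ r~w) with w ≟ s
        ... | yes refl = inj₁ (~-sym s~a)
        ... | no w≢s = inj₂ (guarded (proj₁ minM) M⊆S r~w w≢s)
        replace (inj₂ ℓ~w) = inj₁ (subst (a ~_) (leaf-nbr-unique leaf (~-sym q~ℓ) ℓ~w) a~q)

    height-4⇒¬WTD : ∀ {x} → h x ≡ 4 → ⊥
    height-4⇒¬WTD {x₄} h₄ with h-down h₄
    ... | x₃ , x₄~x₃ , h₃ with h-down h₃
    ... | x₂ , x₃~x₂ , h₂ with h-down h₂
    ... | x₁ , x₂~x₁ , h₁ with h≡1⇒support h₁
    ... | x₀ , x₁~x₀ , leaf =
      guarded-chain⇒¬WTD x₄~x₃ x₃~x₂ x₂~x₁ x₁~x₀ (≢-heights h₂ h₄ λ ()) h₃ h₂ h₁ leaf guard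
      where
      guard : ∀ {c} → x₄ ~ c → c ≢ x₃ → Guarded x₄ c
      guard {c} x₄~c _ with h-adj x₄~c
      ... | inj₁ hc≡1+h₄ = guarded-high (≤-reflexive (sym (trans hc≡1+h₄ (cong suc h₄)))) x₄~c
      ... | inj₂ h₄≡1+hc =
        let hc = suc-injective (trans (sym h₄≡1+hc) h₄)
            g , c~g , hg = h-down hc
        in  guarded-via-V₂ c~g (≢-heights hg h₄ λ ()) hc hg

    module _ (c1 : Cond1 G) (c2 : Cond2 G) where

      two-V₂-nbrs⇒¬WTD : ∀ {v w w′} → h v ≡ 1 → v ~ w → v ~ w′ → w ≢ w′ → h w ≡ 2 → h w′ ≡ 2 → ⊥
      two-V₂-nbrs⇒¬WTD {v} {w} {w′} hv v~w v~w′ w≢w′ hw hw′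
        with second-nbr (h≡suc⇒¬Leaf hw′) (~-sym v~w′)
      ... | y′ , w′~y′ , y′≢v with V₂-other-nbr c2 hw′ (~-sym v~w′) hv w′~y′ y′≢v
      ... | hy′ with second-nbr (h≡suc⇒¬Leaf hy′) (~-sym w′~y′)
      ... | a , y′~a , a≢w′ with V₃-nbr c1 hy′ y′~a
      ... | ha with h-down ha
      ... | q , a~q , hq with h≡1⇒support hq
      ... | ℓ , q~ℓ , leaf = guarded-chain⇒¬WTD w′~y′ y′~a a~q q~ℓ a≢w′ hy′ ha hq leaf guard
        where
        guard : ∀ {c} → w′ ~ c → c ≢ y′ → Guarded w′ c
        guard {c} w′~c _ with c ≟ v
        ... | yes refl =
          let y , w~y , y≢v = second-nbr (h≡suc⇒¬Leaf hw) (~-sym v~w)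
              hy = V₂-other-nbr c2 hw (~-sym v~w) hv w~y y≢v
          in  w , y , v~w , w~y , w≢w′ , y≢v , no-support-nbr (inj₂ (≤-reflexive (sym hy)))
        ... | no c≢v =
          let hc = V₂-other-nbr c2 hw′ (~-sym v~w′) hv w′~c c≢v
              g , c~g , g≢w′ = second-nbr (h≡suc⇒¬Leaf hc) (~-sym w′~c)
          in  guarded-via-V₂ c~g g≢w′ hc (V₃-nbr c1 hc c~g)

  module _ (conn : Connected G) (acyc : Acyclic G) (bal : Balanced G) where
    open BalancedTree conn acyc bal

    WTD⇒Cond1 : WTD G → Cond1 G
    WTD⇒Cond1 wtd v k hv with k ≤? 3
    ... | yes k≤3 = k≤3
    ... | no k≰3 = ⊥-elim (height-4⇒¬WTD conn acyc bal wtd (proj₂ (heights-downward-closed (k ∸ 4)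
                     (trans (Height⇒h hv) (sym (m+[n∸m]≡n (≰⇒> k≰3)))))))

    WTD⇒Cond2 : WTD G → Cond2 G
    WTD⇒Cond2 wtd v hv = let u , v~u , hu = Height-down hv in
      u , v~u , hu , λ w v~w hw → decidable-stable (w ≟ u) λ w≢u →
        let ℓ , u~ℓ , leaf = h≡1⇒support (Height⇒h hu)
            ℓ′ , w~ℓ′ , leaf′ = h≡1⇒support (Height⇒h hw)
        in  two-support-nbrs⇒¬WTD conn acyc bal wtd v~w v~u w≢u w~ℓ′ u~ℓ leaf′ leaf

    WTD⇒Cond3 : WTD G → Cond1 G → Cond2 G → Cond3 G
    WTD⇒Cond3 wtd c1 c2 v hv w w′ v~w hw v~w′ hw′ = decidable-stable (w ≟ w′) λ w≢w′ →
      two-V₂-nbrs⇒¬WTD conn acyc bal wtd c1 c2 (Height⇒h hv) v~w v~w′ w≢w′ (Height⇒h hw) (Height⇒h hw′)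

    -- Balanced trees satisfying (1)–(3) are well-totally dominated

    module _ (c1 : Cond1 G) (c2 : Cond2 G) (c3 : Cond3 G) where

      module _ {S} (minS : IsMinimalTDS G S) where
        private
          tds : IsTDS G S
          tds = proj₁ minS

          support-in-V₁ : ∀ {u} → h u ≡ 1 → u ∈ S ∩ V₁
          support-in-V₁ hu = x∈p∩q⁺ (support∈TDS tds hu , ∈⟦⟧⁺ hu)

          ∈S∩V₁⁻ : ∀ {u} → u ∈ S ∩ V₁ → h u ≡ 1
          ∈S∩V₁⁻ u∈ = ∈⟦⟧⁻ (proj₂ (x∈p∩q⁻ S V₁ u∈))

          ∈S∖V₁⁺ : ∀ {y} → y ∈ S → h y ≢ 1 → y ∈ S ∩ ∁ V₁
          ∈S∖V₁⁺ y∈S hy≢1 = x∈p∩q⁺ (y∈S , x∉p⇒x∈∁p (hy≢1 ∘ ∈⟦⟧⁻))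

          ∈S∖V₁⁻ : ∀ {y} → y ∈ S ∩ ∁ V₁ → y ∈ S × h y ≢ 1
          ∈S∖V₁⁻ y∈ = let y∈S , y∈∁V₁ = x∈p∩q⁻ S (∁ V₁) y∈ in y∈S , x∈∁p⇒x∉p y∈∁V₁ ∘ ∈⟦⟧⁺

        no-V₃-member : ∀ {x} → x ∈ S → h x ≢ 3
        no-V₃-member x∈S hx = minimal⇒irredundant minS x∈S (remove-TDS tds λ x~z →
          let u , z~u , hu = h-down (V₃-nbr c1 hx x~z)
          in  u , x∈p∧x≢y⇒x∈p-y (support∈TDS tds hu) (≢-heights hu hx λ ()) , ~-sym z~u)

        non-support-member : ∀ {x} → x ∈ S → h x ≢ 1 → h x ≡ 0 ⊎ h x ≡ 2
        non-support-member {x} x∈S hx≢1 with h x in hx | h≤3 c1 x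
        ... | 0 | _ = inj₁ refl
        ... | 1 | _ = contradiction refl hx≢1
        ... | 2 | _ = inj₂ refl
        ... | 3 | _ = contradiction hx (no-V₃-member x∈S)
        ... | suc (suc (suc (suc _))) | s≤s (s≤s (s≤s ()))

        leaf-member-redundant : ∀ {t u y} → Leaf G t → t ∈ S → t ~ u → y ∈ S → y ≢ t → y ~ u → ⊥
        leaf-member-redundant {y = y} leaf t∈S t~u y∈S y≢t y~u =
          minimal⇒irredundant minS t∈S (remove-TDS tds λ t~z →
            y , x∈p∧x≢y⇒x∈p-y y∈S y≢t , subst (_ ~_) (leaf-nbr-unique leaf t~u t~z) y~u)

        support-partner : ∀ {u} → u ∈ S ∩ V₁ → ∃! _≡_ λ y → y ∈ S ∩ ∁ V₁ × u ~ y
        support-partner {u} u∈ with tds u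
        ... | t , t∈S , t~u = t , (∈S∖V₁⁺ t∈S (h≢1 t~u) , ~-sym t~u) , λ {y} (y∈ , u~y) →
          let y∈S , hy≢1 = ∈S∖V₁⁻ y∈
          in  decidable-stable (t ≟ y) (distinct-partners (non-support-member t∈S (h≢1 t~u))
                                                          (non-support-member y∈S hy≢1) y∈S (~-sym u~y))
          where
          hu : h u ≡ 1
          hu = ∈S∩V₁⁻ u∈
          h≢1 : ∀ {x} → x ~ u → h x ≢ 1
          h≢1 x~u hx = h-adj-≢ x~u (trans hx (sym hu))
          distinct-partners : ∀ {y} → h t ≡ 0 ⊎ h t ≡ 2 → h y ≡ 0 ⊎ h y ≡ 2 → y ∈ S → y ~ u → t ≢ y → ⊥
          distinct-partners (inj₁ ht) _ y∈S y~u t≢y =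
            leaf-member-redundant (h≡0⇒Leaf t~u ht) t∈S t~u y∈S (t≢y ∘ sym) y~u
          distinct-partners (inj₂ _) (inj₁ hy) y∈S y~u t≢y =
            leaf-member-redundant (h≡0⇒Leaf y~u hy) y∈S y~u t∈S t≢y t~u
          distinct-partners (inj₂ ht) (inj₂ hy) y∈S y~u t≢y =
            t≢y (c3 u (h⇒Height hu) t _ (~-sym t~u) (h⇒Height ht) (~-sym y~u) (h⇒Height hy))

        non-support-partner : ∀ {y} → y ∈ S ∩ ∁ V₁ → ∃! _≡_ λ u → u ∈ S ∩ V₁ × u ~ y
        non-support-partner {y} y∈ with ∈S∖V₁⁻ y∈
        ... | y∈S , hy≢1 with non-support-member y∈S hy≢1
        ...   | inj₁ hy =
          let t , t∈S , t~y = tds y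
              leaf = h≡0⇒Leaf (~-sym t~y) hy
          in  t , (support-in-V₁ (leaf-support leaf t~y) , t~y) ,
              λ (_ , u~y) → leaf-nbr-unique leaf (~-sym t~y) (~-sym u~y)
        ...   | inj₂ hy =
          let u , y~u , Hu , unique = c2 y (h⇒Height hy)
          in  u , (support-in-V₁ (Height⇒h Hu) , ~-sym y~u) ,
              λ (u′∈ , u′~y) → sym (unique _ (~-sym u′~y) (h⇒Height (∈S∩V₁⁻ u′∈)))

        ∣S∣≡2∣V₁∣ : ∣ S ∣ ≡ ∣ V₁ ∣ + ∣ V₁ ∣
        ∣S∣≡2∣V₁∣ = begin
          ∣ S ∣                          ≡⟨ ∣p∣≡∣p∩q∣+∣p∩∁q∣ S V₁ ⟩
          ∣ S ∩ V₁ ∣ + ∣ S ∩ ∁ V₁ ∣      ≡⟨ cong (∣ S ∩ V₁ ∣ +_) matching ⟨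
          ∣ S ∩ V₁ ∣ + ∣ S ∩ V₁ ∣        ≡⟨ cong (λ p → ∣ p ∣ + ∣ p ∣) S∩V₁≡V₁ ⟩
          ∣ V₁ ∣ + ∣ V₁ ∣                ∎
          where
          open ≡-Reasoning
          matching : ∣ S ∩ V₁ ∣ ≡ ∣ S ∩ ∁ V₁ ∣
          matching = matching⇒∣p∣≡∣q∣ _~?_ (S ∩ V₁) (S ∩ ∁ V₁) support-partner non-support-partner
          S∩V₁≡V₁ : S ∩ V₁ ≡ V₁
          S∩V₁≡V₁ = ⊆-antisym (p∩q⊆q S V₁) λ u∈V₁ → support-in-V₁ (∈⟦⟧⁻ u∈V₁)

      conditions⇒WTD : WTD G
      conditions⇒WTD S S′ minS minS′ = trans (∣S∣≡2∣V₁∣ minS) (sym (∣S∣≡2∣V₁∣ minS′))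

theorem4p13 : (n : ℕ) (G : Graph n) → IsTree G → Balanced G →
    (WTD G ⇔ (Cond1 G × Cond2 G × Cond3 G))
theorem4p13 n G (_ , conn , acyc) bal = mk⇔
  (λ wtd → let c1 = WTD⇒Cond1 G conn acyc bal wtd
               c2 = WTD⇒Cond2 G conn acyc bal wtd
           in  c1 , c2 , WTD⇒Cond3 G conn acyc bal wtd c1 c2)
  (λ (c1 , c2 , c3) → conditions⇒WTD G conn acyc bal c1 c2 c3)
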